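{- Let $p$ be a prime and let $A$ be an $n\times n$ subring matrix with diagonal $(p^{e_1}, \ldots, p^{e_{n-1}}, 1)$, where $e_1,\dots,e_{n-1}\ge0$. Let $I = \{i_1,\ldots, i_k\}$ with $1 \le i_1<\cdots < i_k \le n-1$ be the set of indices $j$ with $e_j \neq 0$. Then the corank of $\operatorname{col}(A)$ equals $k$.
   Context: For $u,w\in\mathbb Z^n$, $u\circ w$ is the componentwise product. An invertible matrix $A=(a_{ij})\in M_n(\mathbb Z)$ is in Hermite normal form if it is upper triangular and $0\le a_{ij}<a_{ii}$ for $1\le i<j\le n$. A subring matrix is an invertible integer matrix in Hermite normal form whose column span $\operatorname{col}(A)$ contains $(1,\dots,1)^T$ and is closed under $\circ$ (i.e. $\operatorname{col}(A)$ is a subring of $\mathbb Z^n$). The corank of a finite-index subgroup $\Lambda\subseteq\mathbb Z^n$ is the rank (number of nontrivial invariant factors) of $\mathbb Z^n/\Lambda$. -}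

module Defs where

open import Data.Nat as ℕ using (ℕ; zero; suc)
open import Data.Integer as ℤ using (ℤ; +_; 0ℤ; 1ℤ)
open import Data.Fin as Fin using (Fin; zero; suc; inject₁; fromℕ)
open import Data.Fin.Properties using () renaming (_≟_ to _≟F_)
open import Data.List using (List; length; filter)
open import Data.Fin.Base using (_<_)
open import Data.Product using (Σ; ∃; _×_; _,_)
open import Relation.Nullary using (¬_; yes; no; ¬?)
open import Relation.Binary.PropositionalEquality using (_≡_; _≢_)
import Data.List as List
import Data.Fin as F

Vecℤ : ℕ → Set
Vecℤ n = Fin n → ℤ

Mat : ℕ → Set
Mat n = Fin n → Fin n → ℤ

Σℤ : ∀ {n} → (Fin n → ℤ) → ℤ
Σℤ {zero}  f = 0ℤ
Σℤ {suc n} f = f zero ℤ.+ Σℤ (λ i → f (suc i))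

_·_ : ∀ {n} → Mat n → Vecℤ n → Vecℤ n
(A · x) i = Σℤ (λ j → A i j ℤ.* x j)

_∘ᶜ_ : ∀ {n} → Vecℤ n → Vecℤ n → Vecℤ n
(u ∘ᶜ w) i = u i ℤ.* w i

ones : ∀ {n} → Vecℤ n
ones _ = 1ℤ

col : ∀ {n} → Mat n → Vecℤ n → Set
col {n} A v = Σ (Vecℤ n) (λ x → ∀ i → v i ≡ (A · x) i)

scalarId : ∀ {n} → ℤ → Mat n
scalarId d i j with i ≟F j
... | yes _ = d
... | no  _ = 0ℤ

-- invertible (over ℚ, i.e. nonzero determinant): A B = d I for some
-- integer matrix B and nonzero integer d
Invertible : ∀ {n} → Mat n → Set
Invertible {n} A =
  Σ ℤ (λ d → d ≢ 0ℤ × Σ (Mat n) (λ B →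
    ∀ i j → Σℤ (λ k → A i k ℤ.* B k j) ≡ scalarId d i j))

UpperTriangular : ∀ {n} → Mat n → Set
UpperTriangular A = ∀ i j → j < i → A i j ≡ 0ℤ

IsHNF : ∀ {n} → Mat n → Set
IsHNF A = UpperTriangular A ×
  (∀ i j → i < j → (0ℤ ℤ.≤ A i j) × (A i j ℤ.< A i i))

IsSubringMatrix : ∀ {n} → Mat n → Set
IsSubringMatrix A = Invertible A × IsHNF A × col A ones ×
  (∀ u w → col A u → col A w → col A (u ∘ᶜ w))

-- Λ + span(g₁,…,g_m) = ℤ^n, i.e. ℤ^n/Λ is generated by m elements
GeneratedModBy : ∀ {n} → (Vecℤ n → Set) → ℕ → Set
GeneratedModBy {n} Λ m = Σ (Fin m → Vecℤ n) (λ g →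
  (v : Vecℤ n) → Σ (Fin m → ℤ) (λ c → Σ (Vecℤ n) (λ l → Λ l ×
    ((i : Fin n) → v i ≡ Σℤ (λ t → c t ℤ.* g t i) ℤ.+ l i))))

-- corank of Λ = rank of the finite abelian group ℤ^n/Λ
-- (= minimal number of generators = number of nontrivial invariant factors)
Corank : ∀ {n} → (Vecℤ n → Set) → ℕ → Set
Corank Λ r = GeneratedModBy Λ r × ((m : ℕ) → GeneratedModBy Λ m → r ℕ.≤ m)

countNonzero : ∀ {m} → (Fin m → ℕ) → ℕ
countNonzero {m} e = length (filter (λ j → ¬? (e j ℕ.≟ 0)) (List.allFin m))

-- Call a diagonal position a unit if its pivot is 1. Back substitution along the unit pivots
-- reduces every vector modulo col A to one supported on the k non-unit positions, so the k
-- corresponding unit vectors generate ℤⁿ / col A.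
--
-- The lower bound uses that col A is a ring: if u ∈ col A and p divides u at the unit positions,
-- then p divides u everywhere. Going up the rows, a high power of u lies in col A and has its
-- entries below row i divisible by a high power of p; back substitution against the pivot
-- p ^ eᵢ with eᵢ > 0 then shows that p divides its i-th entry, hence p ∣ uᵢ. Consequently, if
-- ℤⁿ / col A is generated by m vectors, the coefficients mod p of a vector with entries in
-- {0, …, p - 1} at the non-unit positions (and 0 elsewhere) determine those entries, which gives
-- an injection (ℤ/p)ᵏ → (ℤ/p)ᵐ and hence k ≤ m.
module Submission where

open import Defs
open import Data.Nat using (ℕ; suc; _^_)
open import Data.Nat.Primality using (Prime; euclidsLemma; prime⇒nonZero; prime⇒nonTrivial)
open import Data.Integer using (+_)
open import Data.Fin using (Fin; inject₁; fromℕ)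
open import Relation.Binary.PropositionalEquality using (_≡_)

open import Data.Empty using (⊥-elim)
open import Data.Fin as Fin using (zero; suc; toℕ; _<_; _≤_)
open import Data.Fin.Induction using (>-weakInduction; >-wellFounded)
import Data.Fin.Properties as Fin
open import Data.Integer as ℤ using (ℤ; 0ℤ; 1ℤ; _+_; _-_; _*_; -_)
open import Data.Integer.DivMod using (_%ℕ_; _/ℕ_; n%ℕd<d; a≡a%ℕn+[a/ℕn]*n)
open import Data.Integer.Divisibility.Signed
  using (_∣_; divides; ∣ᵤ⇒∣; ∣⇒∣ᵤ; ∣-refl; ∣-trans; ∣m∣n⇒∣m+n; ∣m+n∣m⇒∣n; ∣m⇒∣-m;
         ∣n⇒∣m*n; ∣m⇒∣m*n; *-monoʳ-∣; *-monoˡ-∣; *-cancelˡ-∣)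
import Data.Integer.Properties as ℤ
open import Data.Integer.Tactic.RingSolver using (solve-∀)
open import Algebra.Properties.Semiring.Sum ℤ.+-*-semiring
  using (sum; sum-cong-≗; sum-replicate-zero; sum-remove; ∑-distrib-+; *-distribˡ-sum)
open import Data.List as List using (List; _∷_)
open import Data.List.Membership.Propositional.Properties using (∈-lookup; ∈-filter⁺; ∈-filter⁻; ∈-allFin)
import Data.List.Relation.Unary.All as All
open import Data.List.Relation.Unary.AllPairs using (_∷_)
import Data.List.Relation.Unary.Any as Any using (index)
import Data.List.Relation.Unary.Any.Properties as Any using (lookup-index)
open import Data.List.Relation.Unary.Unique.Propositional using (Unique)
import Data.List.Relation.Unary.Unique.Propositional.Properties as Unique
open import Data.Nat as ℕ using (zero)
import Data.Nat.Divisibility as ℕD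
import Data.Nat.Properties as ℕ
open import Data.Product using (∃-syntax; _×_; _,_; proj₁; proj₂; map₂)
open import Data.Sum as Sum using (_⊎_; inj₁; inj₂; [_,_]′)
open import Data.Vec.Functional using (removeAt)
open import Function using (_∘_; case_of_)
open import Induction.WellFounded using (module All)
open import Relation.Binary.Definitions using (tri<; tri≈; tri>)
open import Relation.Binary.PropositionalEquality
  using (_≢_; _≗_; refl; sym; trans; cong; cong₂; subst; module ≡-Reasoning)
open import Relation.Nullary using (Dec; yes; no; ¬?)
open import Relation.Unary using (Pred; Decidable)

Σℤ≡sum : ∀ {n} (f : Vecℤ n) → Σℤ f ≡ sum f
Σℤ≡sum {zero}  f = refl
Σℤ≡sum {suc n} f = cong (_+_ (f zero)) (Σℤ≡sum (f ∘ suc))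

Σℤ-cong : ∀ {n} {f g : Vecℤ n} → f ≗ g → Σℤ f ≡ Σℤ g
Σℤ-cong {f = f} {g} f≗g = trans (Σℤ≡sum f) (trans (sum-cong-≗ f≗g) (sym (Σℤ≡sum g)))

Σℤ-zero : ∀ {n} {f : Vecℤ n} → (∀ i → f i ≡ 0ℤ) → Σℤ f ≡ 0ℤ
Σℤ-zero {n} f≗0 = trans (Σℤ-cong f≗0) (trans (Σℤ≡sum {n} (λ _ → 0ℤ)) (sum-replicate-zero n))

Σℤ-+ : ∀ {n} (f g : Vecℤ n) → Σℤ (λ i → f i + g i) ≡ Σℤ f + Σℤ g
Σℤ-+ f g = trans (Σℤ≡sum (λ i → f i + g i))
                 (trans (∑-distrib-+ f g) (sym (cong₂ _+_ (Σℤ≡sum f) (Σℤ≡sum g))))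

*-distribˡ-Σℤ : ∀ {n} c (f : Vecℤ n) → c * Σℤ f ≡ Σℤ (λ i → c * f i)
*-distribˡ-Σℤ c f = trans (cong (c *_) (Σℤ≡sum f)) (trans (*-distribˡ-sum c f) (sym (Σℤ≡sum (λ i → c * f i))))

Σℤ-remove : ∀ {n} (f : Vecℤ (suc n)) i → Σℤ f ≡ f i + Σℤ (removeAt f i)
Σℤ-remove f i = trans (Σℤ≡sum f) (trans (sum-remove f) (cong (_+_ (f i)) (sym (Σℤ≡sum (removeAt f i)))))

Σℤ-single : ∀ {n} (f : Vecℤ n) i → (∀ j → j ≢ i → f j ≡ 0ℤ) → Σℤ f ≡ f i
Σℤ-single {suc n} f i off = begin
  Σℤ f                      ≡⟨ Σℤ-remove f i ⟩
  f i + Σℤ (removeAt f i)   ≡⟨ cong (_+_ (f i)) (Σℤ-zero (λ j → off _ (Fin.punchInᵢ≢i i j))) ⟩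
  f i + 0ℤ                  ≡⟨ ℤ.+-identityʳ (f i) ⟩
  f i                       ∎
  where open ≡-Reasoning

∣-Σℤ : ∀ {n} {d} {f : Vecℤ n} → (∀ i → d ∣ f i) → d ∣ Σℤ f
∣-Σℤ {zero}  _   = divides 0ℤ refl
∣-Σℤ {suc n} d∣f = ∣m∣n⇒∣m+n (d∣f zero) (∣-Σℤ (d∣f ∘ suc))

∣-Σℤ-except : ∀ {n} {d} (f : Vecℤ n) i → (∀ j → j ≢ i → d ∣ f j) → d ∣ Σℤ f - f i
∣-Σℤ-except {suc n} {d} f i d∣f = subst (d ∣_) rest≡ (∣-Σℤ (λ j → d∣f _ (Fin.punchInᵢ≢i i j)))
  where
  rest≡ : Σℤ (removeAt f i) ≡ Σℤ f - f i
  rest≡ = trans (cancel (f i) _) (cong (_- f i) (sym (Σℤ-remove f i)))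
    where
    cancel : ∀ a b → b ≡ (a + b) - a
    cancel = solve-∀

Σℤ-− : ∀ {n} (f g : Vecℤ n) → Σℤ (λ i → f i - g i) ≡ Σℤ f - Σℤ g
Σℤ-− {zero}  f g = refl
Σℤ-− {suc n} f g = trans (cong (_+_ (f zero - g zero)) (Σℤ-− (f ∘ suc) (g ∘ suc)))
                         (interchange (f zero) (g zero) (Σℤ (f ∘ suc)) (Σℤ (g ∘ suc)))
  where
  interchange : ∀ a b c d → (a - b) + (c - d) ≡ (a + c) - (b + d)
  interchange = solve-∀

∣-Σℤ-− : ∀ {n} {d} {f g : Vecℤ n} → (∀ i → d ∣ f i - g i) → d ∣ Σℤ f - Σℤ g
∣-Σℤ-− {d = d} {f} {g} d∣f-g = subst (d ∣_) (Σℤ-− f g) (∣-Σℤ d∣f-g)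

unit : ∀ {n} → Fin n → Vecℤ n
unit j i = scalarId 1ℤ i j

unit-diag : ∀ {n} (j : Fin n) → unit j j ≡ 1ℤ
unit-diag j with j Fin.≟ j
... | yes _   = refl
... | no j≢j = ⊥-elim (j≢j refl)

unit-off : ∀ {n} {i j : Fin n} → i ≢ j → unit j i ≡ 0ℤ
unit-off {i = i} {j} i≢j with i Fin.≟ j
... | yes i≡j = ⊥-elim (i≢j i≡j)
... | no _    = refl

Σℤ-*-unit : ∀ {n} (f : Vecℤ n) j → Σℤ (λ i → f i * unit j i) ≡ f j
Σℤ-*-unit f j = begin
  Σℤ (λ i → f i * unit j i)  ≡⟨ Σℤ-single _ j off ⟩
  f j * unit j j             ≡⟨ cong (f j *_) (unit-diag j) ⟩
  f j * 1ℤ                   ≡⟨ ℤ.*-identityʳ (f j) ⟩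
  f j                        ∎
  where
  open ≡-Reasoning
  off : ∀ i → i ≢ j → f i * unit j i ≡ 0ℤ
  off i i≢j = trans (cong (f i *_) (unit-off i≢j)) (ℤ.*-zeroʳ (f i))

module _ {n} (A : Mat n) where

  ·-unit : ∀ j i → (A · unit j) i ≡ A i j
  ·-unit j i = Σℤ-*-unit (A i) j

  ·-scale : ∀ c (x : Vecℤ n) i → (A · (λ k → c * x k)) i ≡ c * (A · x) i
  ·-scale c x i = trans (Σℤ-cong (λ k → swap (A i k) c (x k))) (sym (*-distribˡ-Σℤ c (λ k → A i k * x k)))
    where
    swap : ∀ a b d → a * (b * d) ≡ b * (a * d)
    swap = solve-∀

  col-resp-≗ : ∀ {u w} → u ≗ w → col A u → col A w
  col-resp-≗ u≗w (x , u≡Ax) = x , λ i → trans (sym (u≗w i)) (u≡Ax i)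

  col-zero : col A (λ _ → 0ℤ)
  col-zero = (λ _ → 0ℤ) , λ i → sym (Σℤ-zero (λ k → ℤ.*-zeroʳ (A i k)))

  col-column : ∀ j → col A (λ i → A i j)
  col-column j = unit j , λ i → sym (·-unit j i)

  col-+ : ∀ {u w} → col A u → col A w → col A (λ i → u i + w i)
  col-+ {u} {w} (x , u≡Ax) (y , w≡Ay) = (λ k → x k + y k) , λ i → begin
    u i + w i                              ≡⟨ cong₂ _+_ (u≡Ax i) (w≡Ay i) ⟩
    (A · x) i + (A · y) i                  ≡⟨ Σℤ-+ (λ k → A i k * x k) (λ k → A i k * y k) ⟨
    Σℤ (λ k → A i k * x k + A i k * y k)   ≡⟨ Σℤ-cong (λ k → ℤ.*-distribˡ-+ (A i k) (x k) (y k)) ⟨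
    (A · (λ k → x k + y k)) i              ∎
    where open ≡-Reasoning

  col-scale : ∀ c {u} → col A u → col A (λ i → c * u i)
  col-scale c (x , u≡Ax) = (λ k → c * x k) , λ i → trans (cong (c *_) (u≡Ax i)) (sym (·-scale c x i))

  col-− : ∀ {u w} → col A u → col A w → col A (λ i → u i - w i)
  col-− {u} {w} u∈ w∈ =
    col-resp-≗ (λ i → cong (_+_ (u i)) (ℤ.-1*i≡-i (w i))) (col-+ u∈ (col-scale (- 1ℤ) w∈))

-- Generating ℤⁿ modulo the column span

inject₁≤⇒≡⊎< : ∀ {n} {i j : Fin n} → inject₁ i ≤ j → i ≡ j ⊎ i < j
inject₁≤⇒≡⊎< {i = i} i≤j with ℕ.m≤n⇒m<n∨m≡n (subst (ℕ._≤ _) (Fin.toℕ-inject₁ i) i≤j)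
... | inj₁ i<j = inj₂ i<j
... | inj₂ i≡j = inj₁ (Fin.toℕ-injective i≡j)

module _ {n} {A : Mat n} (UT : UpperTriangular A) where

  row-∣ : ∀ {d} (x : Vecℤ n) i → (∀ l → i < l → d ∣ x l) → d ∣ (A · x) i - A i i * x i
  row-∣ {d} x i d∣x = ∣-Σℤ-except (λ l → A i l * x l) i off-diagonal
    where
    off-diagonal : ∀ l → l ≢ i → d ∣ A i l * x l
    off-diagonal l l≢i with Fin.<-cmp l i
    ... | tri< l<i _ _ = subst (d ∣_) (sym (trans (cong (_* x l) (UT i l l<i)) (ℤ.*-zeroˡ (x l)))) (divides 0ℤ refl)
    ... | tri≈ _ l≡i _ = ⊥-elim (l≢i l≡i)
    ... | tri> _ _ i<l = ∣n⇒∣m*n (A i l) (d∣x l i<l)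

  AgreesFrom : Vecℤ n → Fin (suc n) → Set
  AgreesFrom v b = ∃[ l ] col A l × (∀ j → b ≤ j → A j j ≡ 1ℤ → v j ≡ l j)

  agreesFrom-last : ∀ v → AgreesFrom v (fromℕ n)
  agreesFrom-last v = (λ _ → 0ℤ) , col-zero A , λ j n≤j _ →
    ⊥-elim (ℕ.<⇒≱ (Fin.toℕ<n j) (subst (ℕ._≤ toℕ j) (Fin.toℕ-fromℕ n) n≤j))

  -- Column i vanishes below row i, so adding a multiple of it fixes row i without disturbing the rows below.
  agreesFrom-step : ∀ v i → AgreesFrom v (suc i) → AgreesFrom v (inject₁ i)
  agreesFrom-step v i (l , l∈ , agree) with A i i ℤ.≟ 1ℤ
  ... | no nonunit = l , l∈ , λ j i≤j unit-j → case inject₁≤⇒≡⊎< i≤j of λ where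
        (inj₁ refl) → ⊥-elim (nonunit unit-j)
        (inj₂ i<j)  → agree j i<j unit-j
  ... | yes unit-i = l′ , col-+ A l∈ (col-scale A c (col-column A i)) , agree′
    where
    c : ℤ
    c = v i - l i
    l′ : Vecℤ n
    l′ r = l r + c * A r i
    agree′ : ∀ j → inject₁ i ≤ j → A j j ≡ 1ℤ → v j ≡ l′ j
    agree′ j i≤j unit-j with inject₁≤⇒≡⊎< i≤j
    ... | inj₁ refl = trans (fill (v i) (l i)) (cong (λ a → l i + c * a) (sym unit-i))
      where
      fill : ∀ a b → a ≡ b + (a - b) * 1ℤ
      fill = solve-∀
    ... | inj₂ i<j = begin
      v j            ≡⟨ agree j i<j unit-j ⟩
      l j            ≡⟨ ℤ.+-identityʳ (l j) ⟨
      l j + 0ℤ       ≡⟨ cong (_+_ (l j)) (ℤ.*-zeroʳ c) ⟨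
      l j + c * 0ℤ   ≡⟨ cong (λ a → l j + c * a) (UT j i i<j) ⟨
      l′ j           ∎
      where open ≡-Reasoning

  agree-on-units : ∀ v → ∃[ l ] col A l × (∀ j → A j j ≡ 1ℤ → v j ≡ l j)
  agree-on-units v with >-weakInduction (AgreesFrom v) (agreesFrom-last v) (agreesFrom-step v) zero
  ... | l , l∈ , agree = l , l∈ , λ j → agree j ℕ.z≤n

scatter : ∀ {k n} → (Fin k → Fin n) → (Fin k → ℤ) → Vecℤ n
scatter ι c i = Σℤ (λ t → c t * unit (ι t) i)

scatter-outside : ∀ {k n} (ι : Fin k → Fin n) c {i} → (∀ t → ι t ≢ i) → scatter ι c i ≡ 0ℤ
scatter-outside ι c ι≢i = Σℤ-zero (λ t → trans (cong (c t *_) (unit-off (ι≢i t ∘ sym))) (ℤ.*-zeroʳ (c t)))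

scatter-at : ∀ {k n} {ι : Fin k → Fin n} → (∀ {s t} → ι s ≡ ι t → s ≡ t) →
             ∀ c s → scatter ι c (ι s) ≡ c s
scatter-at {ι = ι} ι-injective c s = begin
  scatter ι c (ι s)        ≡⟨ Σℤ-single _ s off ⟩
  c s * unit (ι s) (ι s)   ≡⟨ cong (c s *_) (unit-diag (ι s)) ⟩
  c s * 1ℤ                 ≡⟨ ℤ.*-identityʳ (c s) ⟩
  c s                      ∎
  where
  open ≡-Reasoning
  off : ∀ t → t ≢ s → c t * unit (ι t) (ι s) ≡ 0ℤ
  off t t≢s = trans (cong (c t *_) (unit-off (t≢s ∘ ι-injective ∘ sym))) (ℤ.*-zeroʳ (c t))

record NonunitDiagonal {n} (A : Mat n) (k : ℕ) : Set where
  field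
    position           : Fin k → Fin n
    position-injective : ∀ {s t} → position s ≡ position t → s ≡ t
    position-nonunit   : ∀ t → A (position t) (position t) ≢ 1ℤ
    position-complete  : ∀ i → A i i ≢ 1ℤ → ∃[ t ] position t ≡ i

  scatter-unit : ∀ c {i} → A i i ≡ 1ℤ → scatter position c i ≡ 0ℤ
  scatter-unit c unit-i = scatter-outside position c λ t t≡i →
    position-nonunit t (subst (λ j → A j j ≡ 1ℤ) (sym t≡i) unit-i)

module _ {n} {A : Mat n} (UT : UpperTriangular A) {k} (N : NonunitDiagonal A k) where
  open NonunitDiagonal N

  decompose-mod-col : ∀ v → ∃[ c ] ∃[ l ] col A l × (∀ i → v i ≡ scatter position c i + l i)
  decompose-mod-col v with agree-on-units UT v
  ... | l , l∈ , agree = c , l , l∈ , v≡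
    where
    c : Fin k → ℤ
    c t = v (position t) - l (position t)
    v≡ : ∀ i → v i ≡ scatter position c i + l i
    v≡ i with A i i ℤ.≟ 1ℤ
    ... | yes unit-i = trans (agree i unit-i) (sym (trans (cong (_+ l i) (scatter-unit c unit-i)) (ℤ.+-identityˡ (l i))))
    ... | no nonunit with position-complete i nonunit
    ...   | t , refl = trans (split (v i) (l i)) (cong (_+ l i) (sym (scatter-at position-injective c t)))
      where
      split : ∀ a b → a ≡ (a - b) + b
      split = solve-∀

  generatedModBy-nonunit : GeneratedModBy (col A) k
  generatedModBy-nonunit = (λ t → unit (position t)) , decompose-mod-col

-- Divisibility in the subring

^-monoʳ-∣ : ∀ q {a b} → a ℕ.≤ b → q ℤ.^ a ∣ q ℤ.^ b
^-monoʳ-∣ q {a} {b} a≤b = divides (q ℤ.^ (b ℕ.∸ a)) (begin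
  q ℤ.^ b                          ≡⟨ cong (q ℤ.^_) (ℕ.m+[n∸m]≡n a≤b) ⟨
  q ℤ.^ (a ℕ.+ (b ℕ.∸ a))          ≡⟨ ℤ.^-distribˡ-+-* q a (b ℕ.∸ a) ⟩
  q ℤ.^ a * q ℤ.^ (b ℕ.∸ a)        ≡⟨ ℤ.*-comm (q ℤ.^ a) _ ⟩
  q ℤ.^ (b ℕ.∸ a) * q ℤ.^ a        ∎)
  where open ≡-Reasoning

^-monoˡ-∣ : ∀ k {a b} → a ∣ b → a ℤ.^ k ∣ b ℤ.^ k
^-monoˡ-∣ zero    a∣b = ∣-refl
^-monoˡ-∣ (suc k) {a} {b} a∣b = ∣-trans (*-monoˡ-∣ (a ℤ.^ k) a∣b) (*-monoʳ-∣ b (^-monoˡ-∣ k a∣b))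

^-nonZero : ∀ {q} → q ≢ 0ℤ → ∀ k → ℤ.NonZero (q ℤ.^ k)
^-nonZero {q} q≢0 k = ℤ.≢-nonZero (q≢0 ∘ ℤ.i^n≡0⇒i≡0 q k)

∣-cancel-− : ∀ {d a b} → d ∣ a → d ∣ a - b → d ∣ b
∣-cancel-− {d} {a} {b} d∣a d∣a-b = subst (d ∣_) (ℤ.neg-involutive b) (∣m⇒∣-m (∣m+n∣m⇒∣n d∣a-b d∣a))

module _ {n} {A : Mat n} (UT : UpperTriangular A) (q : ℤ) (q≢0 : q ≢ 0ℤ) {s : ℕ}
         (pivot∣ : ∀ i → A i i ∣ q ℤ.^ s) where

  -- Solving A x = w from the bottom up divides by a pivot, a divisor of q ^ s, in every row;
  -- scaling row i by q ^ weight i keeps all of these divisions integral.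
  weight : Fin n → ℕ
  weight i = s ℕ.* (n ℕ.∸ suc (toℕ i))

  weight-step : ∀ {i l} → i < l → weight l ℕ.+ s ℕ.≤ weight i
  weight-step {i} {l} i<l = begin
    weight l ℕ.+ s                 ≡⟨ ℕ.+-comm (weight l) s ⟩
    s ℕ.+ weight l                 ≡⟨ ℕ.*-suc s _ ⟨
    s ℕ.* suc (n ℕ.∸ suc (toℕ l))  ≡⟨ cong (s ℕ.*_) (ℕ.+-∸-assoc 1 (Fin.toℕ<n l)) ⟨
    s ℕ.* (n ℕ.∸ toℕ l)            ≤⟨ ℕ.*-monoʳ-≤ s (ℕ.∸-monoʳ-≤ n i<l) ⟩
    weight i                       ∎
    where open ℕ.≤-Reasoning

  weight-bound : ∀ i → weight i ℕ.≤ s ℕ.* n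
  weight-bound i = ℕ.*-monoʳ-≤ s (ℕ.m∸n≤m n (suc (toℕ i)))

  scaled-row-∣ : ∀ {d} (x : Vecℤ n) i → (∀ l → i < l → d ∣ q ℤ.^ (weight l ℕ.+ s) * x l) →
                 d ∣ q ℤ.^ weight i * (A · x) i - A i i * (q ℤ.^ weight i * x i)
  scaled-row-∣ {d} x i below = subst (λ a → d ∣ a - A i i * (q ℤ.^ weight i * x i))
    (·-scale A (q ℤ.^ weight i) x i)
    (row-∣ UT (λ k → q ℤ.^ weight i * x k) i
      (λ l i<l → ∣-trans (below l i<l) (*-monoˡ-∣ (x l) (^-monoʳ-∣ q (weight-step i<l)))))

  scaled-solution-∣ : ∀ (x : Vecℤ n) j → (∀ l → j < l → q ℤ.^ suc (s ℕ.* n) ∣ (A · x) l) →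
                      ∀ i → j < i → q ℤ.^ suc (s ℕ.* n) ∣ q ℤ.^ (weight i ℕ.+ s) * x i
  scaled-solution-∣ x j deep = All.wfRec >-wellFounded _ _ step
    where
    D : ℤ
    D = q ℤ.^ suc (s ℕ.* n)
    step : ∀ i → (∀ {l} → i < l → j < l → D ∣ q ℤ.^ (weight l ℕ.+ s) * x l) →
           j < i → D ∣ q ℤ.^ (weight i ℕ.+ s) * x i
    step i below j<i = ∣-trans pivot-term (subst (A i i * (q ℤ.^ weight i * x i) ∣_) regroup
                                                 (*-monoˡ-∣ (q ℤ.^ weight i * x i) (pivot∣ i)))
      where
      pivot-term : D ∣ A i i * (q ℤ.^ weight i * x i)
      pivot-term = ∣-cancel-− (∣n⇒∣m*n (q ℤ.^ weight i) (deep i j<i))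
                              (scaled-row-∣ x i (λ l i<l → below i<l (Fin.<-trans j<i i<l)))
      regroup : q ℤ.^ s * (q ℤ.^ weight i * x i) ≡ q ℤ.^ (weight i ℕ.+ s) * x i
      regroup = trans (shuffle (q ℤ.^ s) (q ℤ.^ weight i) (x i))
                      (cong (_* x i) (sym (ℤ.^-distribˡ-+-* q (weight i) s)))
        where
        shuffle : ∀ a b c → a * (b * c) ≡ (b * a) * c
        shuffle = solve-∀

  col-pivot-∣ : ∀ {w} → col A w → ∀ j → q ∣ A j j →
                (∀ l → j < l → q ℤ.^ suc (s ℕ.* n) ∣ w l) → q ∣ w j
  col-pivot-∣ {w} (x , w≡Ax) j q∣pivot deep = *-cancelˡ-∣ q^w {{^-nonZero q≢0 (weight j)}}
    (subst (q^w * q ∣_) (restore _ _) (∣m∣n⇒∣m+n (∣-trans shallow row-j) pivot-term))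
    where
    q^w : ℤ
    q^w = q ℤ.^ weight j

    row-j : q ℤ.^ suc (s ℕ.* n) ∣ q^w * w j - A j j * (q^w * x j)
    row-j = subst (λ a → _ ∣ q^w * a - A j j * (q^w * x j)) (sym (w≡Ax j))
      (scaled-row-∣ x j (scaled-solution-∣ x j (λ l j<l → subst (_ ∣_) (w≡Ax l) (deep l j<l))))

    shallow : q^w * q ∣ q ℤ.^ suc (s ℕ.* n)
    shallow = subst (_∣ q ℤ.^ suc (s ℕ.* n)) (ℤ.*-comm q q^w) (^-monoʳ-∣ q (ℕ.s≤s (weight-bound j)))

    pivot-term : q^w * q ∣ A j j * (q^w * x j)
    pivot-term = subst (q^w * q ∣_) (swap q^w (A j j) (x j)) (*-monoʳ-∣ q^w (∣m⇒∣m*n (x j) q∣pivot))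
      where
      swap : ∀ a b c → a * (b * c) ≡ b * (a * c)
      swap = solve-∀

    restore : ∀ a b → (a - b) + b ≡ a
    restore = solve-∀

bounded : ∀ {n} (f : Fin n → ℕ) → ∃[ s ] (∀ i → f i ℕ.≤ s)
bounded {zero}  f = 0 , λ ()
bounded {suc n} f with bounded (f ∘ suc)
... | s , f≤s = f zero ℕ.⊔ s , λ where
  zero    → ℕ.m≤m⊔n (f zero) s
  (suc i) → ℕ.≤-trans (f≤s i) (ℕ.m≤n⊔m (f zero) s)

module _ {p} (p-prime : Prime p) where

  private
    P : ℤ
    P = + p

  prime>1 : 1 ℕ.< p
  prime>1 = ℕ.nonTrivial⇒n>1 p {{prime⇒nonTrivial p-prime}}

  euclid-ℤ : ∀ a b → P ∣ a * b → P ∣ a ⊎ P ∣ b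
  euclid-ℤ a b P∣ab = Sum.map ∣ᵤ⇒∣ ∣ᵤ⇒∣
    (euclidsLemma ℤ.∣ a ∣ ℤ.∣ b ∣ p-prime (subst (p ℕD.∣_) (ℤ.abs-* a b) (∣⇒∣ᵤ P∣ab)))

  prime∣^⇒∣ : ∀ {a} k → P ∣ a ℤ.^ k → P ∣ a
  prime∣^⇒∣ zero P∣1 = ⊥-elim (ℕ.<⇒≢ prime>1 (sym (ℕD.∣1⇒≡1 (∣⇒∣ᵤ P∣1))))
  prime∣^⇒∣ {a} (suc k) P∣a^k+1 with euclid-ℤ a (a ℤ.^ k) P∣a^k+1
  ... | inj₁ P∣a   = P∣a
  ... | inj₂ P∣a^k = prime∣^⇒∣ k P∣a^k

  P≢0 : P ≢ 0ℤ
  P≢0 P≡0 = ℕ.≢-nonZero⁻¹ p {{prime⇒nonZero p-prime}} (cong ℤ.∣_∣ P≡0)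

_^ᶜ_ : ∀ {n} → Vecℤ n → ℕ → Vecℤ n
(u ^ᶜ k) i = u i ℤ.^ k

module _ {n} {A : Mat n} (ones∈ : col A ones) (closed : ∀ u w → col A u → col A w → col A (u ∘ᶜ w)) where

  col-^ᶜ : ∀ {u} → col A u → ∀ k → col A (u ^ᶜ k)
  col-^ᶜ u∈ zero    = ones∈
  col-^ᶜ u∈ (suc k) = closed _ _ u∈ (col-^ᶜ u∈ k)

-- The lower bound

%ℕ-≡⇒∣- : ∀ {d} .{{_ : ℕ.NonZero d}} a b → a %ℕ d ≡ b %ℕ d → + d ∣ a - b
%ℕ-≡⇒∣- {d} a b a%d≡b%d = divides (a /ℕ d - b /ℕ d) (begin
  a - b                                        ≡⟨ cong₂ _-_ (a≡a%ℕn+[a/ℕn]*n a d) (a≡a%ℕn+[a/ℕn]*n b d) ⟩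
  (r a + a /ℕ d * + d) - (r b + b /ℕ d * + d)  ≡⟨ cong (λ x → (+ x + a /ℕ d * + d) - _) a%d≡b%d ⟩
  (r b + a /ℕ d * + d) - (r b + b /ℕ d * + d)  ≡⟨ cancel (r b) (a /ℕ d) (b /ℕ d) (+ d) ⟩
  (a /ℕ d - b /ℕ d) * + d                      ∎)
  where
  open ≡-Reasoning
  r : ℤ → ℤ
  r x = + (x %ℕ d)
  cancel : ∀ r x y z → (r + x * z) - (r + y * z) ≡ (x - y) * z
  cancel = solve-∀

∣-small⇒≡0 : ∀ {d m} → d ℕD.∣ m → m ℕ.< d → m ≡ 0
∣-small⇒≡0 {m = zero}  _   _   = refl
∣-small⇒≡0 {m = suc m} d∣m m<d = ⊥-elim (ℕ.<⇒≱ m<d (ℕD.∣⇒≤ d∣m))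

∣-−⇒≡ : ∀ {d a b} → a ℕ.< d → b ℕ.< d → + d ∣ + a - + b → a ≡ b
∣-−⇒≡ {d} {a} {b} a<d b<d d∣a-b =
  [ (λ b≤a → ≥-case a<d b≤a d∣a-b)
  , (λ a≤b → sym (≥-case b<d a≤b (subst (+ d ∣_) (flip (+ a) (+ b)) (∣m⇒∣-m d∣a-b))))
  ]′ (ℕ.≤-total b a)
  where
  flip : ∀ x y → - (x - y) ≡ y - x
  flip = solve-∀
  ≥-case : ∀ {a b} → a ℕ.< d → b ℕ.≤ a → + d ∣ + a - + b → a ≡ b
  ≥-case {a} {b} a<d b≤a d∣a-b = ℕ.≤-antisym (ℕ.m∸n≡0⇒m≤n a∸b≡0) b≤a
    where
    a∸b≡0 : a ℕ.∸ b ≡ 0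
    a∸b≡0 = ∣-small⇒≡0 (∣⇒∣ᵤ (subst (+ d ∣_) (trans (ℤ.[+m]-[+n]≡m⊖n a b) (ℤ.⊖-≥ b≤a)) d∣a-b))
                       (ℕ.≤-<-trans (ℕ.m∸n≤m a b) a<d)

funToFin-cong : ∀ {m q} {f g : Fin m → Fin q} → f ≗ g → Fin.funToFin f ≡ Fin.funToFin g
funToFin-cong {zero}          _   = refl
funToFin-cong {suc m} {q} f≗g = cong₂ (Fin.combine {q}) (f≗g zero) (funToFin-cong (f≗g ∘ suc))

injective⇒exponent-≤ : ∀ {k m q} → 1 ℕ.< q → (Φ : (Fin k → Fin q) → Fin m → Fin q) →
                       (∀ y y′ → Φ y ≗ Φ y′ → y ≗ y′) → k ℕ.≤ m
injective⇒exponent-≤ {k} {m} {q} 1<q Φ Φ-injective =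
  ℕ.≮⇒≥ (λ m<k → ℕ.<⇒≱ (ℕ.^-monoʳ-< q 1<q m<k) (Fin.injective⇒≤ encode-injective))
  where
  decode : Fin (q ^ k) → Fin k → Fin q
  decode = Fin.finToFun {q} {k}
  encode : Fin (q ^ k) → Fin (q ^ m)
  encode = Fin.funToFin ∘ Φ ∘ decode
  encode-injective : ∀ {a b} → encode a ≡ encode b → a ≡ b
  encode-injective {a} {b} eq = begin
    a                          ≡⟨ Fin.funToFin-finToFin {k} {q} a ⟨
    Fin.funToFin (decode a)    ≡⟨ funToFin-cong (Φ-injective _ _ decoded≗) ⟩
    Fin.funToFin (decode b)    ≡⟨ Fin.funToFin-finToFin {k} {q} b ⟩
    b                          ∎
    where
    open ≡-Reasoning
    decoded≗ : Φ (decode a) ≗ Φ (decode b)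
    decoded≗ t = begin
      Φ (decode a) t                       ≡⟨ Fin.finToFun-funToFin (Φ (decode a)) t ⟨
      Fin.finToFun {q} {m} (encode a) t    ≡⟨ cong (λ c → Fin.finToFun {q} {m} c t) eq ⟩
      Fin.finToFun {q} {m} (encode b) t    ≡⟨ Fin.finToFun-funToFin (Φ (decode b)) t ⟩
      Φ (decode b) t                       ∎

module _ {n} {A : Mat n} (UT : UpperTriangular A) (ones∈ : col A ones)
         (closed : ∀ u w → col A u → col A w → col A (u ∘ᶜ w))
         {p} (p-prime : Prime p) (diag : ∀ i → ∃[ k ] A i i ≡ (+ p) ℤ.^ k) where

  private
    P : ℤ
    P = + p

  pivots-∣-power : ∃[ s ] (∀ i → A i i ∣ P ℤ.^ s)
  pivots-∣-power with bounded (proj₁ ∘ diag)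
  ... | s , k≤s = s , λ i → subst (_∣ P ℤ.^ s) (sym (proj₂ (diag i))) (^-monoʳ-∣ P (k≤s i))

  nonunit-pivot-∣ : ∀ i → A i i ≢ 1ℤ → P ∣ A i i
  nonunit-pivot-∣ i nonunit with diag i
  ... | zero  , A≡1 = ⊥-elim (nonunit A≡1)
  ... | suc k , A≡P^k+1 = subst (P ∣_) (sym A≡P^k+1) (∣m⇒∣m*n (P ℤ.^ k) ∣-refl)

  col-∣-units⇒∣ : ∀ {u} → col A u → (∀ i → A i i ≡ 1ℤ → P ∣ u i) → ∀ i → P ∣ u i
  col-∣-units⇒∣ {u} u∈ unit∣ with pivots-∣-power
  ... | s , pivot∣ = All.wfRec >-wellFounded _ (λ i → P ∣ u i) step
    where
    N : ℕ
    N = suc (s ℕ.* n)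
    step : ∀ i → (∀ {l} → i < l → P ∣ u l) → P ∣ u i
    step i below with A i i ℤ.≟ 1ℤ
    ... | yes unit-i  = unit∣ i unit-i
    ... | no  nonunit = prime∣^⇒∣ p-prime N
      (col-pivot-∣ UT P (P≢0 p-prime) {s} pivot∣ (col-^ᶜ {A = A} ones∈ closed u∈ N) i
        (nonunit-pivot-∣ i nonunit) (λ l i<l → ^-monoˡ-∣ N (below i<l)))

  ∣-coefficients⇒∣ : ∀ {m} (g : Fin m → Vecℤ n) {v v′ l l′ : Vecℤ n} {c c′ : Fin m → ℤ} →
                     col A l → col A l′ →
                     (∀ i → v i ≡ Σℤ (λ t → c t * g t i) + l i) →
                     (∀ i → v′ i ≡ Σℤ (λ t → c′ t * g t i) + l′ i) →
                     (∀ t → P ∣ c t - c′ t) → (∀ i → A i i ≡ 1ℤ → P ∣ v i - v′ i) →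
                     ∀ i → P ∣ v i - v′ i
  ∣-coefficients⇒∣ g {v} {v′} {l} {l′} {c} {c′} l∈ l′∈ v≡ v′≡ P∣c-c′ P∣v-v′-units i =
    subst (P ∣_) (sym (split i)) (∣m∣n⇒∣m+n (combo-∣ i) (rest-∣ i))
    where
    combo : (Fin _ → ℤ) → Vecℤ n
    combo d i = Σℤ (λ t → d t * g t i)

    combo-∣ : ∀ i → P ∣ combo c i - combo c′ i
    combo-∣ i = ∣-Σℤ-− (λ t → subst (P ∣_) (distrib (c t) (c′ t) (g t i)) (∣m⇒∣m*n (g t i) (P∣c-c′ t)))
      where
      distrib : ∀ a b d → (a - b) * d ≡ a * d - b * d
      distrib = solve-∀

    split : ∀ i → v i - v′ i ≡ (combo c i - combo c′ i) + (l i - l′ i)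
    split i = trans (cong₂ _-_ (v≡ i) (v′≡ i)) (regroup (combo c i) (l i) (combo c′ i) (l′ i))
      where
      regroup : ∀ a b d e → (a + b) - (d + e) ≡ (a - d) + (b - e)
      regroup = solve-∀

    rest-∣ : ∀ i → P ∣ l i - l′ i
    rest-∣ = col-∣-units⇒∣ (col-− A l∈ l′∈) λ i unit-i →
      ∣m+n∣m⇒∣n (subst (P ∣_) (split i) (P∣v-v′-units i unit-i)) (combo-∣ i)

  generators-≥-nonunit : ∀ {k} → NonunitDiagonal A k → ∀ {m} → GeneratedModBy (col A) m → k ℕ.≤ m
  generators-≥-nonunit {k} N {m} (g , decompose) =
    injective⇒exponent-≤ (prime>1 p-prime) Φ Φ-injective
    where
    open NonunitDiagonal N
    instance
      p-nonZero : ℕ.NonZero p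
      p-nonZero = prime⇒nonZero p-prime

    digits : (Fin k → Fin p) → Fin k → ℤ
    digits y t = + toℕ (y t)

    embed : (Fin k → Fin p) → Vecℤ n
    embed y = scatter position (digits y)

    coeff : (Fin k → Fin p) → Fin m → ℤ
    coeff y = proj₁ (decompose (embed y))

    rest : (Fin k → Fin p) → Vecℤ n
    rest y = proj₁ (proj₂ (decompose (embed y)))

    rest∈ : ∀ y → col A (rest y)
    rest∈ y = proj₁ (proj₂ (proj₂ (decompose (embed y))))

    embed≡ : ∀ y i → embed y i ≡ Σℤ (λ t → coeff y t * g t i) + rest y i
    embed≡ y = proj₂ (proj₂ (proj₂ (decompose (embed y))))

    Φ : (Fin k → Fin p) → Fin m → Fin p
    Φ y t = Fin.fromℕ< (n%ℕd<d (coeff y t) p)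

    Φ-injective : ∀ y y′ → Φ y ≗ Φ y′ → y ≗ y′
    Φ-injective y y′ Φy≗Φy′ s = Fin.toℕ-injective (∣-−⇒≡ (Fin.toℕ<n (y s)) (Fin.toℕ<n (y′ s))
      (subst (P ∣_) (cong₂ _-_ (scatter-at position-injective (digits y) s)
                                (scatter-at position-injective (digits y′) s))
        (∣-coefficients⇒∣ g {c = coeff y} {coeff y′} (rest∈ y) (rest∈ y′) (embed≡ y) (embed≡ y′)
           coeff-∣ embed-units-∣ (position s))))
      where
      coeff-∣ : ∀ t → P ∣ coeff y t - coeff y′ t
      coeff-∣ t = %ℕ-≡⇒∣- (coeff y t) (coeff y′ t)
        (trans (sym (Fin.toℕ-fromℕ< _)) (trans (cong toℕ (Φy≗Φy′ t)) (Fin.toℕ-fromℕ< _)))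

      embed-units-∣ : ∀ i → A i i ≡ 1ℤ → P ∣ embed y i - embed y′ i
      embed-units-∣ i unit-i = subst (P ∣_)
        (sym (cong₂ _-_ (scatter-unit (digits y) unit-i) (scatter-unit (digits y′) unit-i))) (divides 0ℤ refl)

  corank-nonunit : ∀ {k} → NonunitDiagonal A k → Corank (col A) k
  corank-nonunit N = generatedModBy-nonunit UT N , λ _ → generators-≥-nonunit N

lookup-injective : ∀ {a} {X : Set a} {xs : List X} → Unique xs →
                   ∀ {s t} → List.lookup xs s ≡ List.lookup xs t → s ≡ t
lookup-injective (_ ∷ _)                 {zero}  {zero}  _  = refl
lookup-injective (x∉xs ∷ _)              {zero}  {suc t} eq = ⊥-elim (All.lookup x∉xs (∈-lookup t) eq)
lookup-injective (x∉xs ∷ _)              {suc s} {zero}  eq = ⊥-elim (All.lookup x∉xs (∈-lookup s) (sym eq))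
lookup-injective (_ ∷ xs-unique)         {suc s} {suc t} eq = cong suc (lookup-injective xs-unique eq)

module _ {m ℓ} {Q : Pred (Fin m) ℓ} (Q? : Decidable Q) where

  enumerate : Fin (List.length (List.filter Q? (List.allFin m))) → Fin m
  enumerate = List.lookup (List.filter Q? (List.allFin m))

  enumerate-injective : ∀ {s t} → enumerate s ≡ enumerate t → s ≡ t
  enumerate-injective = lookup-injective (Unique.filter⁺ Q? (Unique.allFin⁺ m))

  enumerate-sound : ∀ t → Q (enumerate t)
  enumerate-sound t = proj₂ (∈-filter⁻ Q? {xs = List.allFin m} (∈-lookup t))

  enumerate-complete : ∀ {j} → Q j → ∃[ t ] enumerate t ≡ j
  enumerate-complete {j} Qj = Any.index j∈ , sym (Any.lookup-index j∈)
    where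
    j∈ = ∈-filter⁺ Q? (∈-allFin j) Qj

inject₁-or-last : ∀ {m} (i : Fin (suc m)) → (∃[ j ] inject₁ j ≡ i) ⊎ fromℕ m ≡ i
inject₁-or-last {m} i with m ℕ.≟ toℕ i
... | yes m≡i = inj₂ (Fin.toℕ-injective (trans (Fin.toℕ-fromℕ m) m≡i))
... | no  m≢i = inj₁ (Fin.lower₁ i m≢i , Fin.inject₁-lower₁ i m≢i)

pos-^ : ∀ a k → + (a ^ k) ≡ (+ a) ℤ.^ k
pos-^ a zero    = refl
pos-^ a (suc k) = trans (ℤ.pos-* a (a ^ k)) (cong (+ a *_) (pos-^ a k))

module _ {p} (p-prime : Prime p) {m} (e : Fin m → ℕ) (A : Mat (suc m))
         (diag-init : ∀ j → A (inject₁ j) (inject₁ j) ≡ + (p ^ e j))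
         (diag-last : A (fromℕ m) (fromℕ m) ≡ + 1) where

  prime-power-pivots : ∀ i → ∃[ k ] A i i ≡ (+ p) ℤ.^ k
  prime-power-pivots i with inject₁-or-last i
  ... | inj₁ (j , refl) = e j , trans (diag-init j) (pos-^ p (e j))
  ... | inj₂ refl       = 0 , diag-last

  prime-power≡1⇒0 : ∀ {k} → + (p ^ k) ≡ 1ℤ → k ≡ 0
  prime-power≡1⇒0 {k} p^k≡1 with ℕ.m^n≡1⇒n≡0∨m≡1 p k (cong ℤ.∣_∣ p^k≡1)
  ... | inj₁ k≡0 = k≡0
  ... | inj₂ p≡1 = ⊥-elim (ℕ.<⇒≢ (prime>1 p-prime) (sym p≡1))

  nonzero-exponents : NonunitDiagonal A (countNonzero e)
  nonzero-exponents = record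
    { position           = inject₁ ∘ enumerate nonzero?
    ; position-injective = enumerate-injective nonzero? ∘ Fin.inject₁-injective
    ; position-nonunit   = λ t unit → enumerate-sound nonzero? t (prime-power≡1⇒0 (trans (sym (diag-init _)) unit))
    ; position-complete  = complete
    }
    where
    -- The predicate filtered by countNonzero, so that enumerate nonzero? has exactly countNonzero e values.
    nonzero? : ∀ j → Dec (e j ≢ 0)
    nonzero? j = ¬? (e j ℕ.≟ 0)
    complete : ∀ i → A i i ≢ 1ℤ → ∃[ t ] inject₁ (enumerate nonzero? t) ≡ i
    complete i nonunit with inject₁-or-last i
    ... | inj₂ refl       = ⊥-elim (nonunit diag-last)
    ... | inj₁ (j , refl) = map₂ (cong inject₁)
      (enumerate-complete nonzero? (nonunit ∘ trans (diag-init j) ∘ cong (λ k → + (p ^ k))))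

theorem4p8 : (p : ℕ) → Prime p → (m : ℕ) → (e : Fin m → ℕ) → (A : Mat (suc m)) →
    IsSubringMatrix A →
    (∀ j → A (inject₁ j) (inject₁ j) ≡ + (p ^ e j)) →
    A (fromℕ m) (fromℕ m) ≡ + 1 →
    Corank (col A) (countNonzero e)
theorem4p8 p p-prime m e A (_ , (UT , _) , ones∈ , closed) diag-init diag-last =
  corank-nonunit UT ones∈ closed p-prime (prime-power-pivots p-prime e A diag-init diag-last)
    (nonzero-exponents p-prime e A diag-init diag-last)
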